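{- For $m,n\geq 0$, the poset $\mathbf{Bub}(m,n)$ is Hasse-regular of degree $m+n$: every element of $\mathbf{Bub}(m,n)$ is involved in exactly $m+n$ covering pairs (as lower or upper element).
   Context: Disjoint alphabets $X=\{x_1,\dots,x_m\}$, $Y=\{y_1,\dots,y_n\}$. A word is simple if it has no repeated letter; $\mathsf{Shuf}(m,n)$ is the set of simple words over $X\cup Y$ in which the letters of $X$ appear in increasing order of index and those of $Y$ in increasing order of index. For $\mathbf{u}=u_1\cdots u_k$, $\mathbf{u}_{\hat\imath}$ is $\mathbf{u}$ with $u_i$ deleted. Indels: $\mathbf{u}\to\mathbf{u}_{\hat\imath}$ if $u_i\in X$, and $\mathbf{u}_{\hat\imath}\to\mathbf{u}$ if $u_i\in Y$. Transpositions: $\mathbf{u}\Rightarrow\mathbf{u}'$ where $u_i\in X$, $u_{i+1}\in Y$ and $\mathbf{u}'$ is $\mathbf{u}$ with $u_i,u_{i+1}$ swapped. The bubble order $\leq_{\mathsf{bub}}$ is the reflexive transitive closure of indels and transpositions; $\mathbf{Bub}(m,n)=(\mathsf{Shuf}(m,n),\leq_{\mathsf{bub}})$. A poset is Hasse-regular of degree $k$ if its Hasse diagram, viewed as a simple undirected graph, is $k$-regular. -}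

module Defs where

open import Level using (Level; _⊔_) renaming (suc to lsuc)
open import Data.Nat using (ℕ)
open import Data.Fin using (Fin)
open import Data.Fin.Base as F using ()
open import Data.Sum using (_⊎_; inj₁; inj₂)
open import Data.Product using (_×_; ∃; ∃-syntax; Σ-syntax)
open import Data.Maybe using (Maybe; just; nothing)
open import Data.List using (List; []; _∷_; _++_; length; lookup; removeAt; mapMaybe)
open import Data.List.Relation.Unary.AllPairs using (AllPairs)
open import Data.List.Relation.Unary.Unique.Propositional using (Unique)
open import Data.List.Membership.Propositional using (_∈_)
open import Relation.Binary.PropositionalEquality using (_≡_; _≢_)
open import Relation.Binary.Construct.Closure.ReflexiveTransitive using (Star)
open import Function.Bundles using (_⇔_)

-- Letters: inj₁ i is x_{i+1} ∈ X, inj₂ j is y_{j+1} ∈ Y (X, Y disjoint).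
Letter : ℕ → ℕ → Set
Letter m n = Fin m ⊎ Fin n

Word : ℕ → ℕ → Set
Word m n = List (Letter m n)

isX : ∀ {m n} → Letter m n → Maybe (Fin m)
isX (inj₁ i) = just i
isX (inj₂ _) = nothing

isY : ∀ {m n} → Letter m n → Maybe (Fin n)
isY (inj₁ _) = nothing
isY (inj₂ j) = just j

record Shuf {m n : ℕ} (u : Word m n) : Set where
  field
    simple : Unique u
    X-incr : AllPairs F._<_ (mapMaybe isX u)
    Y-incr : AllPairs F._<_ (mapMaybe isY u)

IsX : ∀ {m n} → Letter m n → Set
IsX {m} {n} a = ∃[ i ] (a ≡ inj₁ {B = Fin n} i)

IsY : ∀ {m n} → Letter m n → Set
IsY {m} {n} a = ∃[ j ] (a ≡ inj₂ {A = Fin m} j)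

data Move {m n : ℕ} : Word m n → Word m n → Set where
  delX : (u : Word m n) (i : Fin (length u)) → IsX (lookup u i) → Move u (removeAt u i)
  insY : (u : Word m n) (i : Fin (length u)) → IsY (lookup u i) → Move (removeAt u i) u
  swapXY : (p s : Word m n) (a b : Letter m n) → IsX a → IsY b →
           Move (p ++ a ∷ b ∷ s) (p ++ b ∷ a ∷ s)

data Step {m n : ℕ} (u v : Word m n) : Set where
  step : Shuf u → Shuf v → Move u v → Step u v

_≤bub_ : ∀ {m n} → Word m n → Word m n → Set
_≤bub_ = Star Step

module _ {a p r : Level} {A : Set a} (P : A → Set p) (_≤_ : A → A → Set r) where

  Covers : A → A → Set (a ⊔ p ⊔ r)
  Covers u v = P u × P v × u ≤ v × u ≢ v ×
               (∀ w → P w → u ≤ w → w ≤ v → (w ≡ u) ⊎ (w ≡ v))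

  -- Hasse-regular of degree k: every element has exactly k neighbours in the
  -- (undirected) Hasse diagram, witnessed by a duplicate-free list of them.
  HasseRegular : ℕ → Set (a ⊔ p ⊔ r)
  HasseRegular k = ∀ u → P u → ∃[ L ] (Unique L × length L ≡ k ×
                     (∀ v → (v ∈ L) ⇔ (Covers v u ⊎ Covers u v)))

module Submission where

-- Every covering pair of Bub(m,n) is a single elementary move, and exactly three kinds of
-- moves are covers: deleting an x not followed by a y, inserting a y not followed by an
-- x, and transposing xy into yx (the other indels factor through a transposition).  To
-- see that these are covers, note that going up X-letters only disappear, Y-letters
-- only appear and y-before-x pairs persist; this invariant ⊑ is antisymmetric on shuffle
-- words, so nothing lies strictly between the two ends of such a move.
-- Consequently every u has one neighbour per letter c: if c occurs in u, delete it or
-- transpose it with the following letter of the other alphabet; otherwise insert it at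
-- the one place compatible with the index order where it is not followed by a letter of
-- the other alphabet.  Distinct letters give distinct neighbours (c can be read off where
-- u and the neighbour first differ), so u has exactly m + n of them.

open import Defs
open import Data.Empty using (⊥; ⊥-elim)
open import Data.Fin using (Fin; zero; suc; _<_)
open import Data.Fin.Properties using (<-trans; <-irrefl; <-asym; <-cmp; +↔⊎)
open import Data.List using (List; []; _∷_; _++_; length; lookup; removeAt; mapMaybe; map; allFin)
open import Data.List.Membership.Propositional using (_∈_; _∉_)
open import Data.List.Membership.Propositional.Properties using (∈-insert; ∈-++⁺ʳ; ∈-map⁺; ∈-map⁻; ∈-allFin)
open import Data.List.Properties using (++-assoc; ++-cancelˡ; ∷-injectiveˡ; ∷-injectiveʳ; length-map; length-tabulate)
open import Data.List.Relation.Unary.All as All using (All; _∷_)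
open import Data.List.Relation.Unary.AllPairs using (AllPairs; []; _∷_)
open import Data.List.Relation.Unary.Any as Any using (here; there)
open import Data.List.Relation.Unary.Unique.Propositional using (Unique)
open import Data.List.Relation.Unary.Unique.Propositional.Properties using (map⁺; allFin⁺)
open import Data.Maybe using (Maybe; just; nothing)
open import Data.Maybe.Properties using (just-injective)
open import Data.Maybe.Relation.Unary.All as Maybe using (just; nothing; drop-just)
open import Data.Nat using (ℕ; _+_)
open import Data.Nat.Properties using (1+n≢n)
open import Data.Product using (_×_; _,_; proj₁; proj₂; ∃-syntax)
open import Data.Sum as Sum using (_⊎_; inj₁; inj₂)
open import Data.Sum.Properties using (≡-dec)
open import Function using (_∘_; id)
open import Function.Bundles using (_⇔_; mk⇔; _↔_; Inverse)
open import Function.Construct.Composition using (_⇔-∘_)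
open import Relation.Binary.Construct.Closure.ReflexiveTransitive using (ε; _◅_)
open import Relation.Binary.Definitions using (tri<; tri≈; tri>)
open import Relation.Binary.PropositionalEquality using (_≡_; _≢_; refl; sym; trans; cong; subst; subst₂; module ≡-Reasoning)
open import Relation.Nullary using (¬_; Dec; yes; no)

module _ {ℓ} {A : Set ℓ} where

  ∈-insert⁺ : ∀ {e c : A} p s → e ∈ p ++ s → e ∈ p ++ c ∷ s
  ∈-insert⁺ []      s e∈s         = there e∈s
  ∈-insert⁺ (_ ∷ p) s (here refl) = here refl
  ∈-insert⁺ (_ ∷ p) s (there e∈)  = there (∈-insert⁺ p s e∈)

  ∈-delete⁺ : ∀ {e c : A} p s → e ≢ c → e ∈ p ++ c ∷ s → e ∈ p ++ s
  ∈-delete⁺ []      s e≢c e∈          = Any.tail e≢c e∈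
  ∈-delete⁺ (_ ∷ p) s e≢c (here refl) = here refl
  ∈-delete⁺ (_ ∷ p) s e≢c (there e∈)  = there (∈-delete⁺ p s e≢c e∈)

  ∈-swap⁺ : ∀ {e c d : A} p s → e ∈ p ++ c ∷ d ∷ s → e ∈ p ++ d ∷ c ∷ s
  ∈-swap⁺ []      s (here refl)         = there (here refl)
  ∈-swap⁺ []      s (there (here refl)) = here refl
  ∈-swap⁺ []      s (there (there e∈s)) = there (there e∈s)
  ∈-swap⁺ (_ ∷ p) s (here refl)         = here refl
  ∈-swap⁺ (_ ∷ p) s (there e∈)          = there (∈-swap⁺ p s e∈)

  ∷≢ : ∀ {c : A} {s} → c ∷ s ≢ s
  ∷≢ = 1+n≢n ∘ cong length

  insertion≢ : ∀ p (c : A) s → p ++ c ∷ s ≢ p ++ s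
  insertion≢ p c s = ∷≢ ∘ ++-cancelˡ p (c ∷ s) s

  removeAt-split : (u : List A) (i : Fin (length u)) →
                   ∃[ p ] ∃[ s ] (u ≡ p ++ lookup u i ∷ s × removeAt u i ≡ p ++ s)
  removeAt-split (c ∷ u) zero    = [] , u , refl , refl
  removeAt-split (c ∷ u) (suc i) with removeAt-split u i
  ... | p , s , u≡ , r≡ = c ∷ p , s , cong (c ∷_) u≡ , cong (c ∷_) r≡

  removeAt-middle : ∀ p (c : A) s →
                    ∃[ i ] (lookup (p ++ c ∷ s) i ≡ c × removeAt (p ++ c ∷ s) i ≡ p ++ s)
  removeAt-middle []      c s = zero , refl , refl
  removeAt-middle (d ∷ p) c s with removeAt-middle p c s
  ... | i , l≡ , r≡ = suc i , l≡ , cong (d ∷_) r≡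

  data Before (a b : A) : List A → Set ℓ where
    here  : ∀ {u} → b ∈ u → Before a b (a ∷ u)
    there : ∀ {c u} → Before a b u → Before a b (c ∷ u)

  Before⇒∈ˡ : ∀ {a b u} → Before a b u → a ∈ u
  Before⇒∈ˡ (here _)  = here refl
  Before⇒∈ˡ (there p) = there (Before⇒∈ˡ p)

  Before⇒∈ʳ : ∀ {a b u} → Before a b u → b ∈ u
  Before⇒∈ʳ (here b∈u) = there b∈u
  Before⇒∈ʳ (there p)  = there (Before⇒∈ʳ p)

  Before-tail : ∀ {a b c u} → a ≢ c → Before a b (c ∷ u) → Before a b u
  Before-tail a≢c (here _)  = ⊥-elim (a≢c refl)
  Before-tail a≢c (there p) = p

  Before-++⁺ʳ : ∀ {a b} p {s} → Before a b s → Before a b (p ++ s)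
  Before-++⁺ʳ []      q = q
  Before-++⁺ʳ (_ ∷ p) q = there (Before-++⁺ʳ p q)

  Before-middle : ∀ {c e} p {s} → e ∈ s → Before c e (p ++ c ∷ s)
  Before-middle p e∈s = Before-++⁺ʳ p (here e∈s)

  Before-total : ∀ {a b u} → a ∈ u → b ∈ u → a ≢ b → Before a b u ⊎ Before b a u
  Before-total (here refl)  (here refl)  a≢b = ⊥-elim (a≢b refl)
  Before-total (here refl)  (there b∈u)  _   = inj₁ (here b∈u)
  Before-total (there a∈u)  (here refl)  _   = inj₂ (here a∈u)
  Before-total (there a∈u)  (there b∈u)  a≢b with Before-total a∈u b∈u a≢b
  ... | inj₁ p = inj₁ (there p)
  ... | inj₂ p = inj₂ (there p)

  Before-insert⁺ : ∀ {a b c : A} p s → Before a b (p ++ s) → Before a b (p ++ c ∷ s)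
  Before-insert⁺ []      s q         = there q
  Before-insert⁺ (_ ∷ p) s (here b∈) = here (∈-insert⁺ p s b∈)
  Before-insert⁺ (_ ∷ p) s (there q) = there (Before-insert⁺ p s q)

  Before-delete⁺ : ∀ {a b c : A} p s → a ≢ c → b ≢ c → Before a b (p ++ c ∷ s) → Before a b (p ++ s)
  Before-delete⁺ []      s a≢c b≢c q         = Before-tail a≢c q
  Before-delete⁺ (_ ∷ p) s a≢c b≢c (here b∈) = here (∈-delete⁺ p s b≢c b∈)
  Before-delete⁺ (_ ∷ p) s a≢c b≢c (there q) = there (Before-delete⁺ p s a≢c b≢c q)

  Before-swap⁺ : ∀ {a b c d : A} p s → a ≢ c ⊎ b ≢ d → Before a b (p ++ c ∷ d ∷ s) → Before a b (p ++ d ∷ c ∷ s)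
  Before-swap⁺ []      s (inj₁ a≢c) (here _)                 = ⊥-elim (a≢c refl)
  Before-swap⁺ []      s (inj₂ b≢d) (here (here b≡d))        = ⊥-elim (b≢d b≡d)
  Before-swap⁺ []      s (inj₂ _)   (here (there b∈s))       = there (here b∈s)
  Before-swap⁺ []      s _          (there (here b∈s))       = here (there b∈s)
  Before-swap⁺ []      s _          (there (there q))        = there (there q)
  Before-swap⁺ (_ ∷ p) s _          (here b∈)                = here (∈-swap⁺ p s b∈)
  Before-swap⁺ (_ ∷ p) s ne         (there q)                = there (Before-swap⁺ p s ne q)

smaller : ∀ {k} → Fin k → Fin k → Fin k
smaller a b with <-cmp a b
... | tri< _ _ _ = a
... | tri≈ _ _ _ = b
... | tri> _ _ _ = b

smaller-≡ˡ : ∀ {k} {a b : Fin k} → a < b → smaller a b ≡ a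
smaller-≡ˡ {a = a} {b} a<b with <-cmp a b
... | tri< _ _ _   = refl
... | tri≈ _ a≡b _ = ⊥-elim (<-irrefl a≡b a<b)
... | tri> _ _ b<a = ⊥-elim (<-asym a<b b<a)

smaller-≡ʳ : ∀ {k} {a b : Fin k} → b < a → smaller a b ≡ b
smaller-≡ʳ {a = a} {b} b<a with <-cmp a b
... | tri< a<b _ _ = ⊥-elim (<-asym a<b b<a)
... | tri≈ _ _ _   = refl
... | tri> _ _ _   = refl

bound-weaken : ∀ {k} {l : Maybe (Fin k)} {a b} → Maybe.All (_< a) l → a < b → Maybe.All (_< b) l
bound-weaken l<a a<b = Maybe.map (λ c<a → <-trans c<a a<b) l<a

injective-enumeration : ∀ {a b} {A : Set a} {B : Set b} {k} → Fin k ↔ B → (f : B → A) →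
                        (∀ {c d} → f c ≡ f d → c ≡ d) →
                        ∃[ L ] (Unique L × length L ≡ k × (∀ v → (v ∈ L) ⇔ (∃[ c ] v ≡ f c)))
injective-enumeration {A = A} {k = k} e f f-injective =
  map g (allFin k) , map⁺ g-injective (allFin⁺ k) , trans (length-map g (allFin k)) (length-tabulate id) ,
  λ v → mk⇔ to′ from′
  where
  open Inverse e using (to; from; strictlyInverseˡ; strictlyInverseʳ)
  g : Fin k → A
  g = f ∘ to
  g-injective : ∀ {i j} → g i ≡ g j → i ≡ j
  g-injective {i} {j} eq = begin
    i             ≡⟨ strictlyInverseʳ i ⟨
    from (to i)   ≡⟨ cong from (f-injective eq) ⟩
    from (to j)   ≡⟨ strictlyInverseʳ j ⟩
    j             ∎
    where open ≡-Reasoning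
  to′ : ∀ {v} → v ∈ map g (allFin k) → ∃[ c ] v ≡ f c
  to′ v∈L with ∈-map⁻ g v∈L
  ... | i , _ , v≡gi = to i , v≡gi
  from′ : ∀ {v} → ∃[ c ] v ≡ f c → v ∈ map g (allFin k)
  from′ (c , refl) = subst (λ c′ → f c′ ∈ map g (allFin k)) (strictlyInverseˡ c) (∈-map⁺ g (∈-allFin (from c)))

module _ {m n : ℕ} where

  private
    Ltr : Set
    Ltr = Letter m n
    Wd : Set
    Wd = Word m n

  _≟_ : (a b : Ltr) → Dec (a ≡ b)
  _≟_ = ≡-dec Data.Fin._≟_ Data.Fin._≟_

  -- Shuffle lx ly u: u is a shuffle word whose X-letters all exceed lx and
  -- whose Y-letters all exceed ly (nothing meaning no bound).
  data Shuffle : Maybe (Fin m) → Maybe (Fin n) → Wd → Set where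
    []  : ∀ {lx ly} → Shuffle lx ly []
    x∷  : ∀ {lx ly a u} → Maybe.All (_< a) lx → Shuffle (just a) ly u → Shuffle lx ly (inj₁ a ∷ u)
    y∷  : ∀ {lx ly b u} → Maybe.All (_< b) ly → Shuffle lx (just b) u → Shuffle lx ly (inj₂ b ∷ u)

  Shuffle₀ : Wd → Set
  Shuffle₀ = Shuffle nothing nothing

  Above : Maybe (Fin m) → Maybe (Fin n) → Ltr → Set
  Above lx ly (inj₁ a) = Maybe.All (_< a) lx
  Above lx ly (inj₂ b) = Maybe.All (_< b) ly

  boundX : Ltr → Maybe (Fin m) → Maybe (Fin m)
  boundX (inj₁ a) _  = just a
  boundX (inj₂ _) lx = lx

  boundY : Ltr → Maybe (Fin n) → Maybe (Fin n)
  boundY (inj₁ _) ly = ly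
  boundY (inj₂ b) _  = just b

  tail : ∀ {lx ly c u} → Shuffle lx ly (c ∷ u) → Shuffle (boundX c lx) (boundY c ly) u
  tail (x∷ _ s) = s
  tail (y∷ _ s) = s

  ∈-above : ∀ {lx ly u c} → Shuffle lx ly u → c ∈ u → Above lx ly c
  ∈-above (x∷ l<a s) (here refl) = l<a
  ∈-above (y∷ l<b s) (here refl) = l<b
  ∈-above {c = inj₁ _} (x∷ l<a s) (there c∈u) = bound-weaken l<a (drop-just (∈-above s c∈u))
  ∈-above {c = inj₂ _} (x∷ _ s)   (there c∈u) = ∈-above s c∈u
  ∈-above {c = inj₁ _} (y∷ _ s)   (there c∈u) = ∈-above s c∈u
  ∈-above {c = inj₂ _} (y∷ l<b s) (there c∈u) = bound-weaken l<b (drop-just (∈-above s c∈u))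

  head∉tail : ∀ {lx ly c u} → Shuffle lx ly (c ∷ u) → c ∉ u
  head∉tail (x∷ _ s) c∈u = <-irrefl refl (drop-just (∈-above s c∈u))
  head∉tail (y∷ _ s) c∈u = <-irrefl refl (drop-just (∈-above s c∈u))

  middle∉ : ∀ {lx ly} p {c : Ltr} s → Shuffle lx ly (p ++ c ∷ s) → c ∉ p ++ s
  middle∉ []      s sh c∈s           = head∉tail sh c∈s
  middle∉ (_ ∷ p) s sh (here refl)   = head∉tail sh (∈-insert p)
  middle∉ (_ ∷ p) s sh (there c∈ps)  = middle∉ p s (tail sh) c∈ps

  Xs : Wd → List (Fin m)
  Xs = mapMaybe isX

  Ys : Wd → List (Fin n)
  Ys = mapMaybe isY

  ∈-Xs⁻ : ∀ {a} u → a ∈ Xs u → inj₁ a ∈ u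
  ∈-Xs⁻ (inj₁ _ ∷ u) (here refl) = here refl
  ∈-Xs⁻ (inj₁ _ ∷ u) (there a∈u) = there (∈-Xs⁻ u a∈u)
  ∈-Xs⁻ (inj₂ _ ∷ u) a∈u         = there (∈-Xs⁻ u a∈u)

  ∈-Ys⁻ : ∀ {b} u → b ∈ Ys u → inj₂ b ∈ u
  ∈-Ys⁻ (inj₂ _ ∷ u) (here refl) = here refl
  ∈-Ys⁻ (inj₂ _ ∷ u) (there b∈u) = there (∈-Ys⁻ u b∈u)
  ∈-Ys⁻ (inj₁ _ ∷ u) b∈u         = there (∈-Ys⁻ u b∈u)

  Shuffle⇒Shuf : ∀ {lx ly u} → Shuffle lx ly u → Shuf u
  Shuffle⇒Shuf s = record { simple = unique s ; X-incr = X-sorted s ; Y-incr = Y-sorted s }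
    where
    unique : ∀ {lx ly u} → Shuffle lx ly u → AllPairs (λ a b → ¬ a ≡ b) u
    unique {u = []}    _ = []
    unique {u = _ ∷ _} s = All.tabulate (λ { c∈u refl → head∉tail s c∈u }) ∷ unique (tail s)
    X-sorted : ∀ {lx ly u} → Shuffle lx ly u → AllPairs _<_ (Xs u)
    X-sorted []                = []
    X-sorted (x∷ {u = u} _ s) = All.tabulate (λ a∈u → drop-just (∈-above s (∈-Xs⁻ u a∈u))) ∷ X-sorted s
    X-sorted (y∷ _ s)         = X-sorted s
    Y-sorted : ∀ {lx ly u} → Shuffle lx ly u → AllPairs _<_ (Ys u)
    Y-sorted []                = []
    Y-sorted (y∷ {u = u} _ s) = All.tabulate (λ b∈u → drop-just (∈-above s (∈-Ys⁻ u b∈u))) ∷ Y-sorted s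
    Y-sorted (x∷ _ s)         = Y-sorted s

  sorted⇒Shuffle : ∀ {lx ly} u →
    All (λ a → Maybe.All (_< a) lx) (Xs u) → AllPairs _<_ (Xs u) →
    All (λ b → Maybe.All (_< b) ly) (Ys u) → AllPairs _<_ (Ys u) → Shuffle lx ly u
  sorted⇒Shuffle []           _          _         _          _         = []
  sorted⇒Shuffle (inj₁ a ∷ u) (l<a ∷ lx<) (a< ∷ xs) ly<        ys        =
    x∷ l<a (sorted⇒Shuffle u (All.map just a<) xs ly< ys)
  sorted⇒Shuffle (inj₂ b ∷ u) lx<        xs        (l<b ∷ ly<) (b< ∷ ys) =
    y∷ l<b (sorted⇒Shuffle u lx< xs (All.map just b<) ys)

  Shuf⇒Shuffle₀ : ∀ {u} → Shuf u → Shuffle₀ u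
  Shuf⇒Shuffle₀ {u} s =
    sorted⇒Shuffle u (All.tabulate λ _ → nothing) (Shuf.X-incr s) (All.tabulate λ _ → nothing) (Shuf.Y-incr s)

  Before-asym : ∀ {lx ly u a b} → Shuffle lx ly u → Before a b u → ¬ Before b a u
  Before-asym s (here b∈u) (here a∈u) = head∉tail s a∈u
  Before-asym s (here _)   (there q)  = head∉tail s (Before⇒∈ʳ q)
  Before-asym s (there p)  (here _)   = head∉tail s (Before⇒∈ʳ p)
  Before-asym s (there p)  (there q)  = Before-asym (tail s) p q

  Before-trans : ∀ {lx ly u a b c} → Shuffle lx ly u → Before a b u → Before b c u → Before a c u
  Before-trans s (here a∈u) (here _)   = ⊥-elim (head∉tail s a∈u)
  Before-trans s (here _)   (there q)  = here (Before⇒∈ʳ q)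
  Before-trans s (there p)  (here _)   = ⊥-elim (head∉tail s (Before⇒∈ʳ p))
  Before-trans s (there p)  (there q)  = there (Before-trans (tail s) p q)

  Before⇒<ˣ : ∀ {lx ly u a b} → Shuffle lx ly u → Before (inj₁ a) (inj₁ b) u → a < b
  Before⇒<ˣ s (here b∈u) = drop-just (∈-above (tail s) b∈u)
  Before⇒<ˣ s (there p)  = Before⇒<ˣ (tail s) p

  Before⇒<ʸ : ∀ {lx ly u a b} → Shuffle lx ly u → Before (inj₂ a) (inj₂ b) u → a < b
  Before⇒<ʸ s (here b∈u) = drop-just (∈-above (tail s) b∈u)
  Before⇒<ʸ s (there p)  = Before⇒<ʸ (tail s) p

  <⇒Beforeˣ : ∀ {lx ly u a b} → Shuffle lx ly u → inj₁ a ∈ u → inj₁ b ∈ u → a < b → Before (inj₁ a) (inj₁ b) u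
  <⇒Beforeˣ s a∈u b∈u a<b with Before-total a∈u b∈u (λ { refl → <-irrefl refl a<b })
  ... | inj₁ p = p
  ... | inj₂ p = ⊥-elim (<-asym a<b (Before⇒<ˣ s p))

  <⇒Beforeʸ : ∀ {lx ly u a b} → Shuffle lx ly u → inj₂ a ∈ u → inj₂ b ∈ u → a < b → Before (inj₂ a) (inj₂ b) u
  <⇒Beforeʸ s a∈u b∈u a<b with Before-total a∈u b∈u (λ { refl → <-irrefl refl a<b })
  ... | inj₁ p = p
  ... | inj₂ p = ⊥-elim (<-asym a<b (Before⇒<ʸ s p))

  Before-from : ∀ {lx ly c e} p s → Shuffle lx ly (p ++ c ∷ s) → Before c e (p ++ c ∷ s) → e ∈ s
  Before-from []      s sh (here e∈s) = e∈s
  Before-from []      s sh (there q)  = ⊥-elim (head∉tail sh (Before⇒∈ˡ q))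
  Before-from (_ ∷ p) s sh (here _)   = ⊥-elim (middle∉ (_ ∷ p) s sh (here refl))
  Before-from (_ ∷ p) s sh (there q)  = Before-from p s (tail sh) q

  infix 4 _⊑_
  record _⊑_ (u v : Wd) : Set where
    field
      X⊇  : ∀ {x} → inj₁ x ∈ v → inj₁ x ∈ u
      Y⊆  : ∀ {y} → inj₂ y ∈ u → inj₂ y ∈ v
      YX⊆ : ∀ {y x} → inj₁ x ∈ v → Before (inj₂ y) (inj₁ x) u → Before (inj₂ y) (inj₁ x) v
  open _⊑_

  ⊑-refl : ∀ {u} → u ⊑ u
  ⊑-refl = record { X⊇ = λ x∈ → x∈ ; Y⊆ = λ y∈ → y∈ ; YX⊆ = λ _ p → p }

  ⊑-trans : ∀ {u v w} → u ⊑ v → v ⊑ w → u ⊑ w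
  ⊑-trans u⊑v v⊑w = record
    { X⊇  = λ x∈w → X⊇ u⊑v (X⊇ v⊑w x∈w)
    ; Y⊆  = λ y∈u → Y⊆ v⊑w (Y⊆ u⊑v y∈u)
    ; YX⊆ = λ x∈w p → YX⊆ v⊑w x∈w (YX⊆ u⊑v (X⊇ v⊑w x∈w) p)
    }

  ⊑-∈ : ∀ {u v c} → u ⊑ v → v ⊑ u → c ∈ u → c ∈ v
  ⊑-∈ {c = inj₁ _} _   v⊑u = X⊇ v⊑u
  ⊑-∈ {c = inj₂ _} u⊑v _   = Y⊆ u⊑v

  ⊑-tail : ∀ {lx ly lx′ ly′ c r t} → Shuffle lx ly (c ∷ r) → Shuffle lx′ ly′ (c ∷ t) →
           (c ∷ r) ⊑ (c ∷ t) → r ⊑ t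
  ⊑-tail {c = c} sr st cr⊑ct = record
    { X⊇  = λ x∈t → Any.tail (≢head st x∈t) (X⊇ cr⊑ct (there x∈t))
    ; Y⊆  = λ y∈r → Any.tail (≢head sr y∈r) (Y⊆ cr⊑ct (there y∈r))
    ; YX⊆ = λ x∈t p → Before-tail (≢head sr (Before⇒∈ˡ p)) (YX⊆ cr⊑ct (there x∈t) (there p))
    }
    where
    ≢head : ∀ {lx ly u e} → Shuffle lx ly (c ∷ u) → e ∈ u → e ≢ c
    ≢head s e∈u refl = head∉tail s e∈u

  -- A shuffle word is determined by its letters and by which Y-letters precede which X-letters.
  ⊑-antisym : ∀ {lx ly lx′ ly′ u v} → Shuffle lx ly u → Shuffle lx′ ly′ v → u ⊑ v → v ⊑ u → u ≡ v
  ⊑-antisym {u = []}    {[]}    _  _  _   _   = refl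
  ⊑-antisym {u = []}    {_ ∷ _} _  _  u⊑v v⊑u with ⊑-∈ v⊑u u⊑v (here refl)
  ... | ()
  ⊑-antisym {u = _ ∷ _} {[]}    _  _  u⊑v v⊑u with ⊑-∈ u⊑v v⊑u (here refl)
  ... | ()
  ⊑-antisym {u = c ∷ r} {d ∷ t} su sv u⊑v v⊑u with c ≟ d
  ... | yes refl = cong (c ∷_) (⊑-antisym (tail su) (tail sv) (⊑-tail su sv u⊑v) (⊑-tail sv su v⊑u))
  ... | no c≢d   = ⊥-elim (distinct-heads c d su sv
                     (Any.tail (λ d≡c → c≢d (sym d≡c)) (⊑-∈ v⊑u u⊑v (here refl)))
                     (Any.tail c≢d (⊑-∈ u⊑v v⊑u (here refl))) u⊑v v⊑u)
    where
    distinct-heads : ∀ {lx ly lx′ ly′} c d → Shuffle lx ly (c ∷ r) → Shuffle lx′ ly′ (d ∷ t) →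
                     d ∈ r → c ∈ t → (c ∷ r) ⊑ (d ∷ t) → (d ∷ t) ⊑ (c ∷ r) → ⊥
    distinct-heads (inj₁ _) (inj₁ _) su sv d∈r c∈t _ _ =
      <-asym (drop-just (∈-above (tail su) d∈r)) (drop-just (∈-above (tail sv) c∈t))
    distinct-heads (inj₂ _) (inj₂ _) su sv d∈r c∈t _ _ =
      <-asym (drop-just (∈-above (tail su) d∈r)) (drop-just (∈-above (tail sv) c∈t))
    distinct-heads (inj₂ _) (inj₁ _) su sv d∈r _ u⊑v _ with YX⊆ u⊑v (here refl) (here d∈r)
    ... | there p = head∉tail sv (Before⇒∈ʳ p)
    distinct-heads (inj₁ _) (inj₂ _) su sv _ c∈t _ v⊑u with YX⊆ v⊑u (here refl) (here c∈t)
    ... | there p = head∉tail su (Before⇒∈ʳ p)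

  infix 4 _↝_
  data _↝_ : Wd → Wd → Set where
    delete    : ∀ p x s → p ++ inj₁ x ∷ s ↝ p ++ s
    insert    : ∀ p y s → p ++ s ↝ p ++ inj₂ y ∷ s
    transpose : ∀ p x y s → p ++ inj₁ x ∷ inj₂ y ∷ s ↝ p ++ inj₂ y ∷ inj₁ x ∷ s

  Move⇒↝ : ∀ {u v} → Move u v → u ↝ v
  Move⇒↝ (delX u i (x , u[i]≡x)) with removeAt-split u i
  ... | p , s , u≡ , r≡ rewrite u[i]≡x | u≡ | r≡ = delete p x s
  Move⇒↝ (insY u i (y , u[i]≡y)) with removeAt-split u i
  ... | p , s , u≡ , r≡ rewrite u[i]≡y | u≡ | r≡ = insert p y s
  Move⇒↝ (swapXY p s _ _ (x , refl) (y , refl)) = transpose p x y s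

  ↝⇒Move : ∀ {u v} → u ↝ v → Move u v
  ↝⇒Move (delete p x s) with removeAt-middle p (inj₁ x) s
  ... | i , l≡ , r≡ = subst (Move (p ++ inj₁ x ∷ s)) r≡ (delX _ i (x , l≡))
  ↝⇒Move (insert p y s) with removeAt-middle p (inj₂ y) s
  ... | i , l≡ , r≡ = subst (λ w → Move w (p ++ inj₂ y ∷ s)) r≡ (insY _ i (y , l≡))
  ↝⇒Move (transpose p x y s) = swapXY p s (inj₁ x) (inj₂ y) (x , refl) (y , refl)

  ↝⇒≢ : ∀ {u v} → u ↝ v → u ≢ v
  ↝⇒≢ (delete p x s)      = insertion≢ p (inj₁ x) s
  ↝⇒≢ (insert p y s)      = insertion≢ p (inj₂ y) s ∘ sym
  ↝⇒≢ (transpose p x y s) eq with ∷-injectiveˡ (++-cancelˡ p _ _ eq)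
  ... | ()

  ↝⇒⊑ : ∀ {lx ly u v} → Shuffle lx ly u → u ↝ v → u ⊑ v
  ↝⇒⊑ su (delete p x s) = record
    { X⊇  = ∈-insert⁺ p s
    ; Y⊆  = ∈-delete⁺ p s (λ ())
    ; YX⊆ = λ x′∈v → Before-delete⁺ p s (λ ()) (λ { refl → middle∉ p s su x′∈v })
    }
  ↝⇒⊑ su (insert p y s) = record
    { X⊇  = ∈-delete⁺ p s (λ ())
    ; Y⊆  = ∈-insert⁺ p s
    ; YX⊆ = λ _ → Before-insert⁺ p s
    }
  ↝⇒⊑ su (transpose p x y s) = record
    { X⊇  = ∈-swap⁺ p s
    ; Y⊆  = ∈-swap⁺ p s
    ; YX⊆ = λ _ → Before-swap⁺ p s (inj₁ (λ ()))
    }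

  ≤bub⇒⊑ : ∀ {u v} → u ≤bub v → u ⊑ v
  ≤bub⇒⊑ ε                    = ⊑-refl
  ≤bub⇒⊑ (step su _ mv ◅ u′≤v) = ⊑-trans (↝⇒⊑ (Shuf⇒Shuffle₀ su) (Move⇒↝ mv)) (≤bub⇒⊑ u′≤v)

  infix 4 _⋖_
  _⋖_ : Wd → Wd → Set
  _⋖_ = Covers Shuf _≤bub_

  ↝⇒≤bub : ∀ {u v} → Shuf u → Shuf v → u ↝ v → u ≤bub v
  ↝⇒≤bub su sv mv = step su sv (↝⇒Move mv) ◅ ε

  ⋖⇒↝ : ∀ {u v} → u ⋖ v → u ↝ v
  ⋖⇒↝ (_ , _ , ε , u≢v , _) = ⊥-elim (u≢v refl)
  ⋖⇒↝ (su , _ , step _ sw mv ◅ w≤v , _ , between) with between _ sw (step su sw mv ◅ ε) w≤v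
  ... | inj₁ refl = ⊥-elim (↝⇒≢ (Move⇒↝ mv) refl)
  ... | inj₂ refl = Move⇒↝ mv

  Tight : Wd → Wd → Set
  Tight u v = ∀ {w} → Shuffle₀ w → u ⊑ w → w ⊑ v → w ≡ u ⊎ w ≡ v

  tight-↝⇒⋖ : ∀ {u v} → Shuffle₀ u → Shuffle₀ v → u ↝ v → Tight u v → u ⋖ v
  tight-↝⇒⋖ su sv mv tight =
    Shuffle⇒Shuf su , Shuffle⇒Shuf sv , ↝⇒≤bub (Shuffle⇒Shuf su) (Shuffle⇒Shuf sv) mv , ↝⇒≢ mv ,
    λ _ sw u≤w w≤v → tight (Shuf⇒Shuffle₀ sw) (≤bub⇒⊑ u≤w) (≤bub⇒⊑ w≤v)

  data HeadX : Wd → Set where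
    headX : ∀ {x s} → HeadX (inj₁ x ∷ s)

  data HeadY : Wd → Set where
    headY : ∀ {y s} → HeadY (inj₂ y ∷ s)

  delete-tight : ∀ p x s → Shuffle₀ (p ++ inj₁ x ∷ s) → Shuffle₀ (p ++ s) → ¬ HeadY s →
                 Tight (p ++ inj₁ x ∷ s) (p ++ s)
  delete-tight p x s su sv ¬headY {w} sw u⊑w w⊑v with Any.any? (inj₁ x ≟_) w
  ... | no x∉w  = inj₂ (⊑-antisym sw sv w⊑v v⊑w)
    where
    v⊑w : p ++ s ⊑ w
    v⊑w = record
      { X⊇  = λ x′∈w → ∈-delete⁺ p s (λ { refl → x∉w x′∈w }) (X⊇ u⊑w x′∈w)
      ; Y⊆  = λ y∈v → Y⊆ u⊑w (∈-insert⁺ p s y∈v)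
      ; YX⊆ = λ x′∈w q → YX⊆ u⊑w x′∈w (Before-insert⁺ p s q)
      }
  ... | yes x∈w = inj₁ (⊑-antisym sw su w⊑u u⊑w)
    where
    X-kept : ∀ {x′} → inj₁ x′ ∈ p ++ inj₁ x ∷ s → inj₁ x′ ∈ w
    X-kept {x′} x′∈u with inj₁ x′ ≟ inj₁ x
    ... | yes refl = x∈w
    ... | no x′≢x  = X⊇ w⊑v (∈-delete⁺ p s x′≢x x′∈u)
    -- If y came after x in u, it would come after the X-letter x″ following x
    -- (s does not start with a Y-letter), while x < x″ forces y before x″ in w.
    y-not-after-x : ∀ {y} → Before (inj₂ y) (inj₁ x) w → ¬ Before (inj₁ x) (inj₂ y) (p ++ inj₁ x ∷ s)
    y-not-after-x {y} q q′ = go s ¬headY (Before-from p s su q′) refl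
      where
      go : ∀ s′ → ¬ HeadY s′ → inj₂ y ∈ s′ → s′ ≡ s → ⊥
      go (inj₂ _ ∷ _)   ¬hy _            _    = ¬hy headY
      go (inj₁ x″ ∷ s″) _   (there y∈s″) refl =
        Before-asym su (Before-insert⁺ p s (YX⊆ w⊑v x″∈v (Before-trans sw q x<x″∈w)))
                       (Before-++⁺ʳ p (there (here y∈s″)))
        where
        x″∈v : inj₁ x″ ∈ p ++ s
        x″∈v = ∈-++⁺ʳ p (here refl)
        x<x″∈w : Before (inj₁ x) (inj₁ x″) w
        x<x″∈w = <⇒Beforeˣ sw x∈w (X⊇ w⊑v x″∈v) (Before⇒<ˣ su (Before-middle p (here refl)))
    YX-kept : ∀ {y x′} → inj₁ x′ ∈ p ++ inj₁ x ∷ s → Before (inj₂ y) (inj₁ x′) w →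
              Before (inj₂ y) (inj₁ x′) (p ++ inj₁ x ∷ s)
    YX-kept {y} {x′} x′∈u q with Before-total (∈-insert⁺ p s (Y⊆ w⊑v (Before⇒∈ˡ q))) x′∈u (λ ())
    ... | inj₁ q′ = q′
    ... | inj₂ q′ with inj₁ x′ ≟ inj₁ x
    ...   | yes refl = ⊥-elim (y-not-after-x q q′)
    ...   | no x′≢x  = ⊥-elim (Before-asym sv (Before-delete⁺ p s x′≢x (λ ()) q′)
                                            (YX⊆ w⊑v (∈-delete⁺ p s x′≢x x′∈u) q))
    w⊑u : w ⊑ p ++ inj₁ x ∷ s
    w⊑u = record { X⊇ = X-kept ; Y⊆ = λ y∈w → ∈-insert⁺ p s (Y⊆ w⊑v y∈w) ; YX⊆ = YX-kept }

  insert-tight : ∀ p y s → Shuffle₀ (p ++ s) → Shuffle₀ (p ++ inj₂ y ∷ s) → ¬ HeadX s →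
                 Tight (p ++ s) (p ++ inj₂ y ∷ s)
  insert-tight p y s su sv ¬headX {w} sw u⊑w w⊑v with Any.any? (inj₂ y ≟_) w
  ... | no y∉w  = inj₁ (⊑-antisym sw su w⊑u u⊑w)
    where
    Y-kept : ∀ {y′} → inj₂ y′ ∈ w → inj₂ y′ ∈ p ++ s
    Y-kept y′∈w = ∈-delete⁺ p s (λ { refl → y∉w y′∈w }) (Y⊆ w⊑v y′∈w)
    YX-kept : ∀ {y′ x} → inj₁ x ∈ p ++ s → Before (inj₂ y′) (inj₁ x) w → Before (inj₂ y′) (inj₁ x) (p ++ s)
    YX-kept x∈u q with Before-total (Y-kept (Before⇒∈ˡ q)) x∈u (λ ())
    ... | inj₁ q′ = q′
    ... | inj₂ q′ = ⊥-elim (Before-asym sv (Before-insert⁺ p s q′) (YX⊆ w⊑v (∈-insert⁺ p s x∈u) q))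
    w⊑u : w ⊑ p ++ s
    w⊑u = record { X⊇ = λ x∈u → X⊇ w⊑v (∈-insert⁺ p s x∈u) ; Y⊆ = Y-kept ; YX⊆ = YX-kept }
  ... | yes y∈w = inj₂ (⊑-antisym sw sv w⊑v v⊑w)
    where
    Y-kept : ∀ {y′} → inj₂ y′ ∈ p ++ inj₂ y ∷ s → inj₂ y′ ∈ w
    Y-kept {y′} y′∈v with inj₂ y′ ≟ inj₂ y
    ... | yes refl = y∈w
    ... | no y′≢y  = Y⊆ u⊑w (∈-delete⁺ p s y′≢y y′∈v)
    -- Dual to delete-tight: an X-letter after y in v comes after the Y-letter y″ following y.
    x-not-after-y : ∀ {x} → inj₁ x ∈ w → Before (inj₂ y) (inj₁ x) (p ++ inj₂ y ∷ s) →
                    ¬ Before (inj₁ x) (inj₂ y) w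
    x-not-after-y {x} x∈w q r = go s ¬headX (Before-from p s sv q) refl
      where
      go : ∀ s′ → ¬ HeadX s′ → inj₁ x ∈ s′ → s′ ≡ s → ⊥
      go (inj₁ _ ∷ _)   ¬hx _            _    = ¬hx headX
      go (inj₂ y″ ∷ s″) _   (there x∈s″) refl =
        Before-asym sw (Before-trans sw r y<y″∈w) (YX⊆ u⊑w x∈w (Before-++⁺ʳ p (here x∈s″)))
        where
        y<y″∈w : Before (inj₂ y) (inj₂ y″) w
        y<y″∈w = <⇒Beforeʸ sw y∈w (Y⊆ u⊑w (∈-++⁺ʳ p (here refl))) (Before⇒<ʸ sv (Before-middle p (here refl)))
    YX-kept : ∀ {y′ x} → inj₁ x ∈ w → Before (inj₂ y′) (inj₁ x) (p ++ inj₂ y ∷ s) → Before (inj₂ y′) (inj₁ x) w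
    YX-kept {y′} x∈w q with Before-total (Y-kept (Before⇒∈ˡ q)) x∈w (λ ())
    ... | inj₁ q′ = q′
    ... | inj₂ q′ with inj₂ y′ ≟ inj₂ y
    ...   | yes refl = ⊥-elim (x-not-after-y x∈w q q′)
    ...   | no y′≢y  = ⊥-elim (Before-asym sw q′ (YX⊆ u⊑w x∈w (Before-delete⁺ p s y′≢y (λ ()) q)))
    v⊑w : p ++ inj₂ y ∷ s ⊑ w
    v⊑w = record { X⊇ = λ x∈w → ∈-insert⁺ p s (X⊇ u⊑w x∈w) ; Y⊆ = Y-kept ; YX⊆ = YX-kept }

  transpose-tight : ∀ p x y s → Shuffle₀ (p ++ inj₁ x ∷ inj₂ y ∷ s) → Shuffle₀ (p ++ inj₂ y ∷ inj₁ x ∷ s) →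
                    Tight (p ++ inj₁ x ∷ inj₂ y ∷ s) (p ++ inj₂ y ∷ inj₁ x ∷ s)
  transpose-tight p x y s su sv {w} sw u⊑w w⊑v
    with Before-total (Y⊆ u⊑w (∈-swap⁺ p s (∈-insert p))) (X⊇ w⊑v (∈-swap⁺ p s (∈-insert p))) (λ ())
  ... | inj₁ y<x = inj₂ (⊑-antisym sw sv w⊑v v⊑w)
    where
    YX-kept : ∀ {y′ x′} → inj₁ x′ ∈ w → Before (inj₂ y′) (inj₁ x′) (p ++ inj₂ y ∷ inj₁ x ∷ s) →
              Before (inj₂ y′) (inj₁ x′) w
    YX-kept {y′} {x′} x′∈w q with inj₂ y′ ≟ inj₂ y | inj₁ x′ ≟ inj₁ x
    ... | yes refl | yes refl = y<x
    ... | no y′≢y  | _        = YX⊆ u⊑w x′∈w (Before-swap⁺ p s (inj₁ y′≢y) q)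
    ... | yes refl | no x′≢x  = YX⊆ u⊑w x′∈w (Before-swap⁺ p s (inj₂ x′≢x) q)
    v⊑w : p ++ inj₂ y ∷ inj₁ x ∷ s ⊑ w
    v⊑w = record
      { X⊇  = λ x′∈w → ∈-swap⁺ p s (X⊇ u⊑w x′∈w)
      ; Y⊆  = λ y′∈v → Y⊆ u⊑w (∈-swap⁺ p s y′∈v)
      ; YX⊆ = YX-kept
      }
  ... | inj₂ x<y = inj₁ (⊑-antisym sw su w⊑u u⊑w)
    where
    YX-kept : ∀ {y′ x′} → inj₁ x′ ∈ p ++ inj₁ x ∷ inj₂ y ∷ s → Before (inj₂ y′) (inj₁ x′) w →
              Before (inj₂ y′) (inj₁ x′) (p ++ inj₁ x ∷ inj₂ y ∷ s)
    YX-kept {y′} {x′} x′∈u q with inj₂ y′ ≟ inj₂ y | inj₁ x′ ≟ inj₁ x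
    ... | yes refl | yes refl = ⊥-elim (Before-asym sw x<y q)
    ... | no y′≢y  | _        = Before-swap⁺ p s (inj₁ y′≢y) (YX⊆ w⊑v (∈-swap⁺ p s x′∈u) q)
    ... | yes refl | no x′≢x  = Before-swap⁺ p s (inj₂ x′≢x) (YX⊆ w⊑v (∈-swap⁺ p s x′∈u) q)
    w⊑u : w ⊑ p ++ inj₁ x ∷ inj₂ y ∷ s
    w⊑u = record
      { X⊇  = λ x′∈u → X⊇ w⊑v (∈-swap⁺ p s x′∈u)
      ; Y⊆  = λ y′∈w → ∈-swap⁺ p s (Y⊆ w⊑v y′∈w)
      ; YX⊆ = YX-kept
      }

  data CoveringMove : Wd → Wd → Set where
    delete    : ∀ p x s → ¬ HeadY s → CoveringMove (p ++ inj₁ x ∷ s) (p ++ s)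
    insert    : ∀ p y s → ¬ HeadX s → CoveringMove (p ++ s) (p ++ inj₂ y ∷ s)
    transpose : ∀ p x y s → CoveringMove (p ++ inj₁ x ∷ inj₂ y ∷ s) (p ++ inj₂ y ∷ inj₁ x ∷ s)

  CoveringMove⇒⋖ : ∀ {u v} → Shuffle₀ u → Shuffle₀ v → CoveringMove u v → u ⋖ v
  CoveringMove⇒⋖ su sv (delete p x s ¬hy)  = tight-↝⇒⋖ su sv (delete p x s) (delete-tight p x s su sv ¬hy)
  CoveringMove⇒⋖ su sv (insert p y s ¬hx)  = tight-↝⇒⋖ su sv (insert p y s) (insert-tight p y s su sv ¬hx)
  CoveringMove⇒⋖ su sv (transpose p x y s) = tight-↝⇒⋖ su sv (transpose p x y s) (transpose-tight p x y s su sv)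

  Shuffle-xy⇒yx : ∀ {lx ly} p x y s → Shuffle lx ly (p ++ inj₁ x ∷ inj₂ y ∷ s) → Shuffle lx ly (p ++ inj₂ y ∷ inj₁ x ∷ s)
  Shuffle-xy⇒yx []           x y s (x∷ l<x (y∷ l<y sh)) = y∷ l<y (x∷ l<x sh)
  Shuffle-xy⇒yx (inj₁ _ ∷ p) x y s (x∷ l<a sh)          = x∷ l<a (Shuffle-xy⇒yx p x y s sh)
  Shuffle-xy⇒yx (inj₂ _ ∷ p) x y s (y∷ l<b sh)          = y∷ l<b (Shuffle-xy⇒yx p x y s sh)

  Shuffle-yx⇒xy : ∀ {lx ly} p x y s → Shuffle lx ly (p ++ inj₂ y ∷ inj₁ x ∷ s) → Shuffle lx ly (p ++ inj₁ x ∷ inj₂ y ∷ s)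
  Shuffle-yx⇒xy []           x y s (y∷ l<y (x∷ l<x sh)) = x∷ l<x (y∷ l<y sh)
  Shuffle-yx⇒xy (inj₁ _ ∷ p) x y s (x∷ l<a sh)          = x∷ l<a (Shuffle-yx⇒xy p x y s sh)
  Shuffle-yx⇒xy (inj₂ _ ∷ p) x y s (y∷ l<b sh)          = y∷ l<b (Shuffle-yx⇒xy p x y s sh)

  -- p x y s < p y x s < p y s
  delete-before-Y-not-⋖ : ∀ p x y s → ¬ (p ++ inj₁ x ∷ inj₂ y ∷ s ⋖ p ++ inj₂ y ∷ s)
  delete-before-Y-not-⋖ p x y s (su , sv , _ , _ , between)
    with between _ sw (↝⇒≤bub su sw (transpose p x y s)) (↝⇒≤bub sw sv w↝v)
    where
    sw : Shuf (p ++ inj₂ y ∷ inj₁ x ∷ s)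
    sw = Shuffle⇒Shuf (Shuffle-xy⇒yx p x y s (Shuf⇒Shuffle₀ su))
    w↝v : p ++ inj₂ y ∷ inj₁ x ∷ s ↝ p ++ inj₂ y ∷ s
    w↝v = subst₂ _↝_ (++-assoc p _ _) (++-assoc p _ _) (delete (p ++ inj₂ y ∷ []) x s)
  ... | inj₁ w≡u = ↝⇒≢ (transpose p x y s) (sym w≡u)
  ... | inj₂ w≡v = ∷≢ (∷-injectiveʳ (++-cancelˡ p _ _ w≡v))

  -- p x s < p x y s < p y x s
  insert-before-X-not-⋖ : ∀ p x y s → ¬ (p ++ inj₁ x ∷ s ⋖ p ++ inj₂ y ∷ inj₁ x ∷ s)
  insert-before-X-not-⋖ p x y s (su , sv , _ , _ , between)
    with between _ sw (↝⇒≤bub su sw u↝w) (↝⇒≤bub sw sv (transpose p x y s))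
    where
    sw : Shuf (p ++ inj₁ x ∷ inj₂ y ∷ s)
    sw = Shuffle⇒Shuf (Shuffle-yx⇒xy p x y s (Shuf⇒Shuffle₀ sv))
    u↝w : p ++ inj₁ x ∷ s ↝ p ++ inj₁ x ∷ inj₂ y ∷ s
    u↝w = subst₂ _↝_ (++-assoc p _ _) (++-assoc p _ _) (insert (p ++ inj₁ x ∷ []) y s)
  ... | inj₁ w≡u = ∷≢ (∷-injectiveʳ (++-cancelˡ p _ _ w≡u))
  ... | inj₂ w≡v = ↝⇒≢ (transpose p x y s) w≡v

  ⋖⇒CoveringMove : ∀ {u v} → u ⋖ v → CoveringMove u v
  ⋖⇒CoveringMove u⋖v with ⋖⇒↝ u⋖v
  ... | delete p x []           = delete p x [] λ ()
  ... | delete p x (inj₁ _ ∷ s) = delete p x _ λ ()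
  ... | delete p x (inj₂ y ∷ s) = ⊥-elim (delete-before-Y-not-⋖ p x y s u⋖v)
  ... | insert p y []           = insert p y [] λ ()
  ... | insert p y (inj₂ _ ∷ s) = insert p y _ λ ()
  ... | insert p y (inj₁ x ∷ s) = ⊥-elim (insert-before-X-not-⋖ p x y s u⋖v)
  ... | transpose p x y s       = transpose p x y s

  raiseX : Fin m → Wd → Wd
  raiseX x []           = []
  raiseX x (inj₁ a ∷ s) = inj₁ a ∷ s
  raiseX x (inj₂ b ∷ s) = inj₂ b ∷ inj₁ x ∷ s

  lowerY : Fin n → Wd → Wd
  lowerY y []           = []
  lowerY y (inj₁ a ∷ s) = inj₁ a ∷ inj₂ y ∷ s
  lowerY y (inj₂ b ∷ s) = inj₂ b ∷ s

  neighbourX : Fin m → Wd → Wd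
  neighbourX x []           = inj₁ x ∷ []
  neighbourX x (inj₁ a ∷ r) with <-cmp a x
  ... | tri< _ _ _ = inj₁ a ∷ neighbourX x r
  ... | tri≈ _ _ _ = raiseX x r
  ... | tri> _ _ _ = inj₁ x ∷ inj₁ a ∷ r
  neighbourX x (inj₂ b ∷ r) = inj₂ b ∷ neighbourX x r

  neighbourY : Fin n → Wd → Wd
  neighbourY y []           = inj₂ y ∷ []
  neighbourY y (inj₁ a ∷ r) = inj₁ a ∷ neighbourY y r
  neighbourY y (inj₂ b ∷ r) with <-cmp b y
  ... | tri< _ _ _ = inj₂ b ∷ neighbourY y r
  ... | tri≈ _ _ _ = lowerY y r
  ... | tri> _ _ _ = inj₂ y ∷ inj₂ b ∷ r

  neighbour : Wd → Ltr → Wd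
  neighbour u (inj₁ x) = neighbourX x u
  neighbour u (inj₂ y) = neighbourY y u

  CoveringMove-∷ : ∀ c {u v} → CoveringMove u v → CoveringMove (c ∷ u) (c ∷ v)
  CoveringMove-∷ c (delete p x s ¬hy)  = delete (c ∷ p) x s ¬hy
  CoveringMove-∷ c (insert p y s ¬hx)  = insert (c ∷ p) y s ¬hx
  CoveringMove-∷ c (transpose p x y s) = transpose (c ∷ p) x y s

  raiseX-covering : ∀ x s → CoveringMove (inj₁ x ∷ s) (raiseX x s)
  raiseX-covering x []           = delete [] x [] λ ()
  raiseX-covering x (inj₁ _ ∷ s) = delete [] x _ λ ()
  raiseX-covering x (inj₂ y ∷ s) = transpose [] x y s

  lowerY-covering : ∀ y s → CoveringMove (lowerY y s) (inj₂ y ∷ s)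
  lowerY-covering y []           = insert [] y [] λ ()
  lowerY-covering y (inj₂ _ ∷ s) = insert [] y _ λ ()
  lowerY-covering y (inj₁ x ∷ s) = transpose [] x y s

  neighbourX-covering : ∀ x u → CoveringMove u (neighbourX x u) ⊎ CoveringMove (neighbourX x u) u
  neighbourX-covering x []           = inj₂ (delete [] x [] λ ())
  neighbourX-covering x (inj₁ a ∷ r) with <-cmp a x
  ... | tri< _ _ _    = Sum.map (CoveringMove-∷ _) (CoveringMove-∷ _) (neighbourX-covering x r)
  ... | tri≈ _ refl _ = inj₁ (raiseX-covering x r)
  ... | tri> _ _ _    = inj₂ (delete [] x _ λ ())
  neighbourX-covering x (inj₂ b ∷ r) = Sum.map (CoveringMove-∷ _) (CoveringMove-∷ _) (neighbourX-covering x r)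

  neighbourY-covering : ∀ y u → CoveringMove u (neighbourY y u) ⊎ CoveringMove (neighbourY y u) u
  neighbourY-covering y []           = inj₁ (insert [] y [] λ ())
  neighbourY-covering y (inj₂ b ∷ r) with <-cmp b y
  ... | tri< _ _ _    = Sum.map (CoveringMove-∷ _) (CoveringMove-∷ _) (neighbourY-covering y r)
  ... | tri≈ _ refl _ = inj₂ (lowerY-covering y r)
  ... | tri> _ _ _    = inj₁ (insert [] y _ λ ())
  neighbourY-covering y (inj₁ a ∷ r) = Sum.map (CoveringMove-∷ _) (CoveringMove-∷ _) (neighbourY-covering y r)

  neighbour-covering : ∀ u c → CoveringMove (neighbour u c) u ⊎ CoveringMove u (neighbour u c)
  neighbour-covering u (inj₁ x) = Sum.swap (neighbourX-covering x u)
  neighbour-covering u (inj₂ y) = Sum.swap (neighbourY-covering y u)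

  neighbourX-Shuffle : ∀ {lx ly x u} → Shuffle lx ly u → Maybe.All (_< x) lx → Shuffle lx ly (neighbourX x u)
  neighbourX-Shuffle {u = []}         []          l<x = x∷ l<x []
  neighbourX-Shuffle {lx} {x = x} {inj₁ a ∷ r} (x∷ l<a s) l<x with <-cmp a x
  ... | tri< a<x _ _  = x∷ l<a (neighbourX-Shuffle s (just a<x))
  ... | tri≈ _ refl _ = raise s
    where
    raise : ∀ {ly r} → Shuffle (just x) ly r → Shuffle lx ly (raiseX x r)
    raise []                = []
    raise (x∷ (just x<a) s) = x∷ (bound-weaken l<x x<a) s
    raise (y∷ l<b s)        = y∷ l<b (x∷ l<x s)
  ... | tri> _ _ x<a  = x∷ l<x (x∷ (just x<a) s)
  neighbourX-Shuffle {u = inj₂ b ∷ r} (y∷ l<b s) l<x = y∷ l<b (neighbourX-Shuffle s l<x)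

  neighbourY-Shuffle : ∀ {lx ly y u} → Shuffle lx ly u → Maybe.All (_< y) ly → Shuffle lx ly (neighbourY y u)
  neighbourY-Shuffle {u = []}         []          l<y = y∷ l<y []
  neighbourY-Shuffle {ly = ly} {y} {inj₂ b ∷ r} (y∷ l<b s) l<y with <-cmp b y
  ... | tri< b<y _ _  = y∷ l<b (neighbourY-Shuffle s (just b<y))
  ... | tri≈ _ refl _ = lower s
    where
    lower : ∀ {lx r} → Shuffle lx (just y) r → Shuffle lx ly (lowerY y r)
    lower []                = []
    lower (y∷ (just y<b) s) = y∷ (bound-weaken l<y y<b) s
    lower (x∷ l<a s)        = x∷ l<a (y∷ l<y s)
  ... | tri> _ _ y<b  = y∷ l<y (y∷ (just y<b) s)
  neighbourY-Shuffle {u = inj₁ a ∷ r} (x∷ l<a s) l<y = x∷ l<a (neighbourY-Shuffle s l<y)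

  neighbour-Shuffle : ∀ {u} → Shuffle₀ u → ∀ c → Shuffle₀ (neighbour u c)
  neighbour-Shuffle su (inj₁ _) = neighbourX-Shuffle su nothing
  neighbour-Shuffle su (inj₂ _) = neighbourY-Shuffle su nothing

  -- Of the two distinct letters met where u and neighbour u c first differ, this picks c.
  pick : Ltr → Ltr → Ltr
  pick (inj₁ a) (inj₁ b) = inj₁ (smaller a b)
  pick (inj₂ a) (inj₂ b) = inj₂ (smaller a b)
  pick c        _        = c

  firstDifference : Wd → Wd → Maybe Ltr
  firstDifference []      []      = nothing
  firstDifference []      (d ∷ _) = just d
  firstDifference (c ∷ _) []      = just c
  firstDifference (c ∷ u) (d ∷ v) with c ≟ d
  ... | yes _ = firstDifference u v
  ... | no _  = just (pick c d)

  firstDifference-∷ : ∀ c u v → firstDifference (c ∷ u) (c ∷ v) ≡ firstDifference u v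
  firstDifference-∷ c u v with c ≟ c
  ... | yes _  = refl
  ... | no c≢c = ⊥-elim (c≢c refl)

  firstDifference-≢ : ∀ {c d} u v → c ≢ d → firstDifference (c ∷ u) (d ∷ v) ≡ just (pick c d)
  firstDifference-≢ {c} {d} u v c≢d with c ≟ d
  ... | yes c≡d = ⊥-elim (c≢d c≡d)
  ... | no _    = refl

  firstDifference-neighbourX : ∀ {lx ly x u} → Shuffle lx ly u → Maybe.All (_< x) lx →
                               firstDifference u (neighbourX x u) ≡ just (inj₁ x)
  firstDifference-neighbourX {u = []} _ _ = refl
  firstDifference-neighbourX {x = x} {inj₁ a ∷ r} (x∷ _ s) _ with <-cmp a x
  ... | tri< a<x _ _  = trans (firstDifference-∷ (inj₁ a) r _) (firstDifference-neighbourX s (just a<x))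
  ... | tri≈ _ refl _ = raised r s
    where
    raised : ∀ {ly} r → Shuffle (just x) ly r → firstDifference (inj₁ x ∷ r) (raiseX x r) ≡ just (inj₁ x)
    raised []           _                 = refl
    raised (inj₁ a ∷ r) (x∷ (just x<a) _) =
      trans (firstDifference-≢ {inj₁ x} {inj₁ a} (inj₁ a ∷ r) r λ { refl → <-irrefl refl x<a }) (cong (λ z → just (inj₁ z)) (smaller-≡ˡ x<a))
    raised (inj₂ b ∷ r) _                 = firstDifference-≢ {inj₁ x} {inj₂ b} (inj₂ b ∷ r) (inj₁ x ∷ r) λ ()
  ... | tri> _ _ x<a  =
    trans (firstDifference-≢ {inj₁ a} {inj₁ x} r (inj₁ a ∷ r) λ { refl → <-irrefl refl x<a }) (cong (λ z → just (inj₁ z)) (smaller-≡ʳ x<a))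
  firstDifference-neighbourX {u = inj₂ b ∷ r} (y∷ _ s) x>l =
    trans (firstDifference-∷ (inj₂ b) r _) (firstDifference-neighbourX s x>l)

  firstDifference-neighbourY : ∀ {lx ly y u} → Shuffle lx ly u → Maybe.All (_< y) ly →
                               firstDifference u (neighbourY y u) ≡ just (inj₂ y)
  firstDifference-neighbourY {u = []} _ _ = refl
  firstDifference-neighbourY {y = y} {inj₂ b ∷ r} (y∷ _ s) _ with <-cmp b y
  ... | tri< b<y _ _  = trans (firstDifference-∷ (inj₂ b) r _) (firstDifference-neighbourY s (just b<y))
  ... | tri≈ _ refl _ = lowered r s
    where
    lowered : ∀ {lx} r → Shuffle lx (just y) r → firstDifference (inj₂ y ∷ r) (lowerY y r) ≡ just (inj₂ y)
    lowered []           _                 = refl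
    lowered (inj₂ b ∷ r) (y∷ (just y<b) _) =
      trans (firstDifference-≢ {inj₂ y} {inj₂ b} (inj₂ b ∷ r) r λ { refl → <-irrefl refl y<b }) (cong (λ z → just (inj₂ z)) (smaller-≡ˡ y<b))
    lowered (inj₁ a ∷ r) _                 = firstDifference-≢ {inj₂ y} {inj₁ a} (inj₁ a ∷ r) (inj₂ y ∷ r) λ ()
  ... | tri> _ _ y<b  =
    trans (firstDifference-≢ {inj₂ b} {inj₂ y} r (inj₂ b ∷ r) λ { refl → <-irrefl refl y<b }) (cong (λ z → just (inj₂ z)) (smaller-≡ʳ y<b))
  firstDifference-neighbourY {u = inj₁ a ∷ r} (x∷ _ s) y>l =
    trans (firstDifference-∷ (inj₁ a) r _) (firstDifference-neighbourY s y>l)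

  firstDifference-neighbour : ∀ {u} → Shuffle₀ u → ∀ c → firstDifference u (neighbour u c) ≡ just c
  firstDifference-neighbour su (inj₁ _) = firstDifference-neighbourX su nothing
  firstDifference-neighbour su (inj₂ _) = firstDifference-neighbourY su nothing

  neighbour-injective : ∀ {u} → Shuffle₀ u → ∀ {c d} → neighbour u c ≡ neighbour u d → c ≡ d
  neighbour-injective {u} su {c} {d} eq = just-injective (begin
    just c                              ≡⟨ firstDifference-neighbour su c ⟨
    firstDifference u (neighbour u c)   ≡⟨ cong (firstDifference u) eq ⟩
    firstDifference u (neighbour u d)   ≡⟨ firstDifference-neighbour su d ⟩
    just d                              ∎)
    where open ≡-Reasoning

  raiseX-¬HeadY : ∀ x {s} → ¬ HeadY s → raiseX x s ≡ s
  raiseX-¬HeadY x {[]}         _   = refl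
  raiseX-¬HeadY x {inj₁ _ ∷ _} _   = refl
  raiseX-¬HeadY x {inj₂ _ ∷ _} ¬hy = ⊥-elim (¬hy headY)

  lowerY-¬HeadX : ∀ y {s} → ¬ HeadX s → lowerY y s ≡ s
  lowerY-¬HeadX y {[]}         _   = refl
  lowerY-¬HeadX y {inj₂ _ ∷ _} _   = refl
  lowerY-¬HeadX y {inj₁ _ ∷ _} ¬hx = ⊥-elim (¬hx headX)

  neighbourX-at : ∀ {lx ly} p x s → Shuffle lx ly (p ++ inj₁ x ∷ s) → neighbourX x (p ++ inj₁ x ∷ s) ≡ p ++ raiseX x s
  neighbourX-at [] x s _ with <-cmp x x
  ... | tri< x<x _ _ = ⊥-elim (<-irrefl refl x<x)
  ... | tri≈ _ _ _   = refl
  ... | tri> _ _ x<x = ⊥-elim (<-irrefl refl x<x)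
  neighbourX-at (inj₁ a ∷ p) x s (x∷ _ sh) with <-cmp a x | drop-just (∈-above sh (∈-insert p))
  ... | tri< _ _ _   | _   = cong (inj₁ a ∷_) (neighbourX-at p x s sh)
  ... | tri≈ _ a≡x _ | a<x = ⊥-elim (<-irrefl a≡x a<x)
  ... | tri> _ _ x<a | a<x = ⊥-elim (<-asym a<x x<a)
  neighbourX-at (inj₂ b ∷ p) x s (y∷ _ sh) = cong (inj₂ b ∷_) (neighbourX-at p x s sh)

  neighbourY-at : ∀ {lx ly} p y s → Shuffle lx ly (p ++ inj₂ y ∷ s) → neighbourY y (p ++ inj₂ y ∷ s) ≡ p ++ lowerY y s
  neighbourY-at [] y s _ with <-cmp y y
  ... | tri< y<y _ _ = ⊥-elim (<-irrefl refl y<y)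
  ... | tri≈ _ _ _   = refl
  ... | tri> _ _ y<y = ⊥-elim (<-irrefl refl y<y)
  neighbourY-at (inj₂ b ∷ p) y s (y∷ _ sh) with <-cmp b y | drop-just (∈-above sh (∈-insert p))
  ... | tri< _ _ _   | _   = cong (inj₂ b ∷_) (neighbourY-at p y s sh)
  ... | tri≈ _ b≡y _ | b<y = ⊥-elim (<-irrefl b≡y b<y)
  ... | tri> _ _ y<b | b<y = ⊥-elim (<-asym b<y y<b)
  neighbourY-at (inj₁ a ∷ p) y s (x∷ _ sh) = cong (inj₁ a ∷_) (neighbourY-at p y s sh)

  neighbourX-missing : ∀ {lx ly} p x s → Shuffle lx ly (p ++ inj₁ x ∷ s) → ¬ HeadY s →
                       neighbourX x (p ++ s) ≡ p ++ inj₁ x ∷ s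
  neighbourX-missing [] x []           _                       _   = refl
  neighbourX-missing [] x (inj₂ _ ∷ s) _                       ¬hy = ⊥-elim (¬hy headY)
  neighbourX-missing [] x (inj₁ a ∷ s) (x∷ _ (x∷ (just x<a) _)) _  with <-cmp a x
  ... | tri< a<x _ _ = ⊥-elim (<-asym a<x x<a)
  ... | tri≈ _ a≡x _ = ⊥-elim (<-irrefl (sym a≡x) x<a)
  ... | tri> _ _ _   = refl
  neighbourX-missing (inj₁ a ∷ p) x s (x∷ _ sh) ¬hy with <-cmp a x | drop-just (∈-above sh (∈-insert p))
  ... | tri< _ _ _   | _   = cong (inj₁ a ∷_) (neighbourX-missing p x s sh ¬hy)
  ... | tri≈ _ a≡x _ | a<x = ⊥-elim (<-irrefl a≡x a<x)
  ... | tri> _ _ x<a | a<x = ⊥-elim (<-asym a<x x<a)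
  neighbourX-missing (inj₂ b ∷ p) x s (y∷ _ sh) ¬hy = cong (inj₂ b ∷_) (neighbourX-missing p x s sh ¬hy)

  neighbourY-missing : ∀ {lx ly} p y s → Shuffle lx ly (p ++ inj₂ y ∷ s) → ¬ HeadX s →
                       neighbourY y (p ++ s) ≡ p ++ inj₂ y ∷ s
  neighbourY-missing [] y []           _                       _   = refl
  neighbourY-missing [] y (inj₁ _ ∷ s) _                       ¬hx = ⊥-elim (¬hx headX)
  neighbourY-missing [] y (inj₂ b ∷ s) (y∷ _ (y∷ (just y<b) _)) _  with <-cmp b y
  ... | tri< b<y _ _ = ⊥-elim (<-asym b<y y<b)
  ... | tri≈ _ b≡y _ = ⊥-elim (<-irrefl (sym b≡y) y<b)
  ... | tri> _ _ _   = refl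
  neighbourY-missing (inj₂ b ∷ p) y s (y∷ _ sh) ¬hx with <-cmp b y | drop-just (∈-above sh (∈-insert p))
  ... | tri< _ _ _   | _   = cong (inj₂ b ∷_) (neighbourY-missing p y s sh ¬hx)
  ... | tri≈ _ b≡y _ | b<y = ⊥-elim (<-irrefl b≡y b<y)
  ... | tri> _ _ y<b | b<y = ⊥-elim (<-asym b<y y<b)
  neighbourY-missing (inj₁ a ∷ p) y s (x∷ _ sh) ¬hx = cong (inj₁ a ∷_) (neighbourY-missing p y s sh ¬hx)

  adjacent⇒neighbour : ∀ {u v} → Shuffle₀ u → Shuffle₀ v → CoveringMove v u ⊎ CoveringMove u v →
                       ∃[ c ] v ≡ neighbour u c
  adjacent⇒neighbour su sv (inj₁ (delete p x s ¬hy))  = inj₁ x , sym (neighbourX-missing p x s sv ¬hy)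
  adjacent⇒neighbour su sv (inj₁ (insert p y s ¬hx))  =
    inj₂ y , sym (trans (neighbourY-at p y s su) (cong (p ++_) (lowerY-¬HeadX y ¬hx)))
  adjacent⇒neighbour su sv (inj₁ (transpose p x y s)) = inj₂ y , sym (neighbourY-at p y (inj₁ x ∷ s) su)
  adjacent⇒neighbour su sv (inj₂ (delete p x s ¬hy))  =
    inj₁ x , sym (trans (neighbourX-at p x s su) (cong (p ++_) (raiseX-¬HeadY x ¬hy)))
  adjacent⇒neighbour su sv (inj₂ (insert p y s ¬hx))  = inj₂ y , sym (neighbourY-missing p y s sv ¬hx)
  adjacent⇒neighbour su sv (inj₂ (transpose p x y s)) = inj₁ x , sym (neighbourX-at p x (inj₂ y ∷ s) su)

  neighbour⇔⋖ : ∀ {u v} → Shuf u → (∃[ c ] v ≡ neighbour u c) ⇔ (v ⋖ u ⊎ u ⋖ v)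
  neighbour⇔⋖ {u} {v} su = mk⇔ from to
    where
    su₀ : Shuffle₀ u
    su₀ = Shuf⇒Shuffle₀ su
    to : v ⋖ u ⊎ u ⋖ v → ∃[ c ] v ≡ neighbour u c
    to (inj₁ v⋖u) = adjacent⇒neighbour su₀ (Shuf⇒Shuffle₀ (proj₁ v⋖u)) (inj₁ (⋖⇒CoveringMove v⋖u))
    to (inj₂ u⋖v) = adjacent⇒neighbour su₀ (Shuf⇒Shuffle₀ (proj₁ (proj₂ u⋖v))) (inj₂ (⋖⇒CoveringMove u⋖v))
    from : ∃[ c ] v ≡ neighbour u c → v ⋖ u ⊎ u ⋖ v
    from (c , refl) = Sum.map (CoveringMove⇒⋖ sv su₀) (CoveringMove⇒⋖ su₀ sv) (neighbour-covering u c)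
      where
      sv = neighbour-Shuffle su₀ c

lemma3p6 : (m n : ℕ) → HasseRegular (Shuf {m} {n}) _≤bub_ (m + n)
lemma3p6 m n u su =
  let L , unique , length≡ , ∈⇔neighbour = injective-enumeration +↔⊎ (neighbour u) (neighbour-injective (Shuf⇒Shuffle₀ su))
  in  L , unique , length≡ , λ v → neighbour⇔⋖ su ⇔-∘ ∈⇔neighbour v
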